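{- For any nonempty finite set $S_L$ of positive integers, there exists a finite set $S_R$ of positive integers with $S_L\cap S_R=\emptyset$ and $|S_R|=|S_L|+1$ such that the game $(S_L,S_R)$ has infinitely many positions $n$ with $o(n)=\mathcal R$.
   Context: A partizan subtraction game $(S_L,S_R)$, with $S_L,S_R$ finite sets of positive integers, is played on a heap of $n$ tokens. Two players, Left and Right, alternate moves; Left removes $s\in S_L$ tokens and Right removes $s\in S_R$ tokens (at most the current heap size). A player unable to move loses. The outcome $o(n)$ is $\mathcal L$ (Left wins whoever starts), $\mathcal R$ (Right wins whoever starts), $\mathcal N$ (first player wins) or $\mathcal P$ (second player wins). -}

module Defs where

open import Data.Nat using (ℕ; zero; suc; _∸_; _≤?_; _<_; _>_)
open import Data.Bool using (Bool; true; false; not; _∧_; _∨_)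
open import Data.List using (List; []; _∷_; length)
open import Data.List.Relation.Unary.All using (All)
open import Data.List.Relation.Unary.Unique.Propositional using (Unique)
open import Data.List.Membership.Propositional using (_∈_)
open import Data.Empty using (⊥)
open import Data.Product using (_×_; ∃-syntax)
open import Relation.Nullary using (¬_)
open import Relation.Nullary.Decidable using (⌊_⌋)
open import Relation.Binary.PropositionalEquality using (_≡_)

record FinPosSet : Set where
  constructor mkSet
  field
    elems    : List ℕ
    unique   : Unique elems
    positive : All (λ s → 0 < s) elems
open FinPosSet public

card : FinPosSet → ℕ
card S = length (elems S)

Disjoint : FinPosSet → FinPosSet → Set
Disjoint A B = ∀ {x} → x ∈ elems A → x ∈ elems B → ⊥

anyMove : List ℕ → (ℕ → Bool) → ℕ → Bool
anyMove []       f n = false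
anyMove (s ∷ ss) f n = (⌊ s ≤? n ⌋ ∧ f (n ∸ s)) ∨ anyMove ss f n

-- Fuel-indexed win functions (fuel k ≥ n suffices since all moves are
-- positive).  winL SL SR k n = true iff Left, moving first from a heap of n,
-- wins; winR symmetrically for Right moving first.
mutual
  winL : List ℕ → List ℕ → ℕ → ℕ → Bool
  winL SL SR zero    n = false
  winL SL SR (suc k) n = anyMove SL (λ m → not (winR SL SR k m)) n

  winR : List ℕ → List ℕ → ℕ → ℕ → Bool
  winR SL SR zero    n = false
  winR SL SR (suc k) n = anyMove SR (λ m → not (winL SL SR k m)) n

LeftFirstWins : FinPosSet → FinPosSet → ℕ → Bool
LeftFirstWins SL SR n = winL (elems SL) (elems SR) n n

RightFirstWins : FinPosSet → FinPosSet → ℕ → Bool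
RightFirstWins SL SR n = winR (elems SL) (elems SR) n n

IsRPosition : FinPosSet → FinPosSet → ℕ → Set
IsRPosition SL SR n = (LeftFirstWins SL SR n ≡ false) × (RightFirstWins SL SR n ≡ true)

InfinitelyMany : (ℕ → Set) → Set
InfinitelyMany P = ∀ N → ∃[ n ] (n > N × P n)

{-# OPTIONS --safe #-}
module Submission where

-- Choose P larger than the sum of any two of Left's moves and give Right the
-- moves P and P − s for s ∈ S_L; these are new and pairwise distinct because P
-- exceeds every s and every s + s′.  Every positive multiple of P is then an
-- R-position: whatever s Left removes from qP, Right answers with P − s and
-- restores the multiple (q − 1)P, and moving first Right simply removes P.

open import Defs
open import Data.Nat using (ℕ; zero; suc; _+_; _*_; _∸_; _≤_; _<_; _>_; _≤?_; s≤s; z<s; >-nonZero)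
open import Data.Nat.Properties
open import Data.Nat.ListAction using (sum)
open import Data.Bool using (true; false; not; _∨_)
open import Data.Bool.Properties using (∨-zeroʳ)
open import Data.List using (List; []; _∷_; map)
open import Data.List.Properties using (length-map)
open import Data.List.Relation.Unary.All as All using (All; []; _∷_)
open import Data.List.Relation.Unary.All.Properties as All using ()
open import Data.List.Relation.Unary.AllPairs using ([]; _∷_)
open import Data.List.Relation.Unary.Any using (here; there)
open import Data.List.Relation.Unary.Unique.Propositional using (Unique)
open import Data.List.Membership.Propositional using (_∈_)
open import Data.List.Membership.Propositional.Properties using (∈-map⁺; ∈-map⁻)
open import Data.Product using (_×_; ∃-syntax; _,_)
open import Data.Empty using (⊥-elim)
open import Relation.Nullary using (yes; no)
open import Relation.Binary.PropositionalEquality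

∈⇒≤sum : ∀ {n ns} → n ∈ ns → n ≤ sum ns
∈⇒≤sum {ns = n ∷ ns} (here refl) = m≤m+n n (sum ns)
∈⇒≤sum {ns = m ∷ ns} (there n∈) = ≤-trans (∈⇒≤sum n∈) (m≤n+m (sum ns) m)

map⁺-injectiveOn : ∀ {A B : Set} {f : A → B} {xs : List A} →
  (∀ {x y} → x ∈ xs → y ∈ xs → f x ≡ f y → x ≡ y) → Unique xs → Unique (map f xs)
map⁺-injectiveOn {xs = []} _ [] = []
map⁺-injectiveOn {xs = x ∷ xs} inj (x∉xs ∷ xs!) =
  All.map⁺ (All.tabulate λ y∈ fx≡fy → All.lookup x∉xs y∈ (inj (here refl) (there y∈) fx≡fy))
  ∷ map⁺-injectiveOn (λ x∈ y∈ → inj (there x∈) (there y∈)) xs!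

infinitelyMany-multiples : ∀ {P} {Q : ℕ → Set} → 0 < P → (∀ q → Q (suc q * P)) → InfinitelyMany Q
infinitelyMany-multiples {P} P>0 Q-multiples N = suc N * P , m≤m*n (suc N) P {{>-nonZero P>0}} , Q-multiples N

anyMove-true : ∀ {s ss f n} → s ∈ ss → s ≤ n → f (n ∸ s) ≡ true → anyMove ss f n ≡ true
anyMove-true {s} {n = n} (here refl) s≤n f[n∸s] with s ≤? n
... | yes _   rewrite f[n∸s] = refl
... | no  s≰n = ⊥-elim (s≰n s≤n)
anyMove-true {ss = _ ∷ _} (there s∈) s≤n f[n∸s] =
  trans (cong (_ ∨_) (anyMove-true s∈ s≤n f[n∸s])) (∨-zeroʳ _)

anyMove-false : ∀ {ss f n} → (∀ {s} → s ∈ ss → s ≤ n → f (n ∸ s) ≡ false) → anyMove ss f n ≡ false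
anyMove-false {[]} _ = refl
anyMove-false {s ∷ ss} {n = n} h with s ≤? n
... | yes s≤n rewrite h (here refl) s≤n = anyMove-false (λ s∈ → h (there s∈))
... | no  _ = anyMove-false (λ s∈ → h (there s∈))

module _ (SL SR : List ℕ) where

  winR-suc-byMove : ∀ k {s n} → s ∈ SR → winL SL SR k n ≡ false → winR SL SR (suc k) (s + n) ≡ true
  winR-suc-byMove k {s} {n} s∈ lost =
    anyMove-true s∈ (m≤m+n s n) (cong not (subst (λ m → winL SL SR k m ≡ false) (sym (m+n∸m≡n s n)) lost))

  winL-suc-byReplies : ∀ k {n} → (∀ {s} → s ∈ SL → s ≤ n → winR SL SR k (n ∸ s) ≡ true) →
    winL SL SR (suc k) n ≡ false
  winL-suc-byReplies k replies = anyMove-false (λ s∈ s≤n → cong not (replies s∈ s≤n))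

module ComplementStrategy (SL SR : List ℕ) (P : ℕ)
  (SL-positive : All (0 <_) SL)
  (P∈SR : P ∈ SR)
  (SL-below : ∀ {l} → l ∈ SL → l < P)
  (complement∈SR : ∀ {l} → l ∈ SL → P ∸ l ∈ SR) where

  2≤P : ∀ {l} → l ∈ SL → 2 ≤ P
  2≤P l∈ = ≤-trans (s≤s (All.lookup SL-positive l∈)) (SL-below l∈)

  mutual
    multiple-leftFirstLoses : ∀ k q → q * P ≤ k → winL SL SR k (q * P) ≡ false
    multiple-leftFirstLoses zero    q _    = refl
    multiple-leftFirstLoses (suc k) q qP≤k =
      winL-suc-byReplies SL SR k (λ l∈ l≤qP → complement-rightFirstWins k q l∈ l≤qP qP≤k)

    complement-rightFirstWins : ∀ k q {l} → l ∈ SL → l ≤ q * P → q * P ≤ suc k →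
      winR SL SR k (q * P ∸ l) ≡ true
    complement-rightFirstWins k zero l∈ l≤0 _ = ⊥-elim (<⇒≱ (All.lookup SL-positive l∈) l≤0)
    complement-rightFirstWins zero (suc q) l∈ _ P+qP≤1 =
      ⊥-elim (<⇒≱ (≤-trans (2≤P l∈) (m≤m+n P (q * P))) P+qP≤1)
    complement-rightFirstWins (suc k) (suc q) {l} l∈ _ P+qP≤2+k
      rewrite +-∸-comm (q * P) (<⇒≤ (SL-below l∈)) =
      winR-suc-byMove SL SR k (complement∈SR l∈) (multiple-leftFirstLoses k q qP≤k)
      where
      qP≤k : q * P ≤ k
      qP≤k = +-cancelˡ-≤ 2 (q * P) k (≤-trans (+-monoˡ-≤ (q * P) (2≤P l∈)) P+qP≤2+k)

  multiple-rightFirstWins : ∀ k q → q * P ≤ k → winR SL SR (suc k) (P + q * P) ≡ true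
  multiple-rightFirstWins k q qP≤k = winR-suc-byMove SL SR k P∈SR (multiple-leftFirstLoses k q qP≤k)

module ComplementMoves (SL : FinPosSet) where

  S : ℕ
  S = sum (elems SL)

  P : ℕ
  P = suc (S + S)

  moves : List ℕ
  moves = P ∷ map (P ∸_) (elems SL)

  sum<P : ∀ {x y} → x ∈ elems SL → y ∈ elems SL → x + y < P
  sum<P x∈ y∈ = s≤s (+-mono-≤ (∈⇒≤sum x∈) (∈⇒≤sum y∈))

  ∈⇒<P : ∀ {x} → x ∈ elems SL → x < P
  ∈⇒<P x∈ = ≤-<-trans (m≤m+n _ _) (sum<P x∈ x∈)

  moves-unique : Unique moves
  moves-unique = All.map⁺ (All.tabulate P≢P∸y) ∷ map⁺-injectiveOn P∸-injective (unique SL)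
    where
    P≢P∸y : ∀ {y} → y ∈ elems SL → P ≢ P ∸ y
    P≢P∸y y∈ P≡P∸y = <⇒≢ (∸-monoʳ-< (All.lookup (positive SL) y∈) (<⇒≤ (∈⇒<P y∈))) (sym P≡P∸y)
    P∸-injective : ∀ {x y} → x ∈ elems SL → y ∈ elems SL → P ∸ x ≡ P ∸ y → x ≡ y
    P∸-injective x∈ y∈ = ∸-cancelˡ-≡ (<⇒≤ (∈⇒<P x∈)) (<⇒≤ (∈⇒<P y∈))

  moves-positive : All (0 <_) moves
  moves-positive = z<s ∷ All.map⁺ (All.tabulate (λ y∈ → m<n⇒0<n∸m (∈⇒<P y∈)))

  SR : FinPosSet
  SR = mkSet moves moves-unique moves-positive

  disjoint : Disjoint SL SR
  disjoint x∈ (here refl) = <-irrefl refl (∈⇒<P x∈)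
  disjoint x∈ (there x∈map) with ∈-map⁻ (P ∸_) x∈map
  ... | y , y∈ , refl = <-irrefl (m∸n+n≡m (<⇒≤ (∈⇒<P y∈))) (sum<P x∈ y∈)

  card-SR : card SR ≡ suc (card SL)
  card-SR = cong suc (length-map (P ∸_) (elems SL))

  open ComplementStrategy (elems SL) moves P (positive SL) (here refl) ∈⇒<P (λ l∈ → there (∈-map⁺ (P ∸_) l∈))

  -- suc q * P unfolds to suc (S + S + q * P), the fuel shape of multiple-rightFirstWins.
  multiple-isRPosition : ∀ q → IsRPosition SL SR (suc q * P)
  multiple-isRPosition q =
    multiple-leftFirstLoses (suc q * P) (suc q) ≤-refl ,
    multiple-rightFirstWins (S + S + q * P) q (m≤n+m (q * P) (S + S))

-- The construction also works for empty S_L.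
mainTheorem4 : (SL : FinPosSet) → card SL > 0 →
    ∃[ SR ] (Disjoint SL SR × card SR ≡ suc (card SL) × InfinitelyMany (IsRPosition SL SR))
mainTheorem4 SL _ = SR , disjoint , card-SR , infinitelyMany-multiples z<s multiple-isRPosition
  where open ComplementMoves SL
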